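{- Let $u$ be a set, let $\mathcal{S}$ be a finite set of conjunctive set transformers $G:\mathcal{P}(u)\to\mathcal{P}(u)$ with $G(u)=u$, $S(r)=\bigcap_{G\in\mathcal{S}}G(r)$, $\mathrm{grd}(T)=\overline{T(\varnothing)}$. Let $\mathcal{E}_m=\{(a,b)\mid a,b\subseteq u,\ a\cap\overline{b}\subseteq S(b)\cap\mathrm{grd}(S)\}$ and $\mathcal{E}_w=\bigcup_{G\in\mathcal{S}}\{(a,b)\mid a,b\subseteq u,\ a\cap\overline{b}\subseteq S(a\cup b)\cap\mathrm{grd}(G)\cap G(b)\}$, and for $\mathcal{E}\in\{\mathcal{E}_m,\mathcal{E}_w\}$ let the corresponding $\mathcal{L}_m$, resp. $\mathcal{L}_w$, be the smallest relation on $\mathcal{P}(u)$ containing $\mathcal{E}$ that is transitive and disjunctive (for every $q\subseteq u$ and family $l\subseteq\mathcal{P}(u)$ with $(p,q)$ in the relation for all $p\in l$, $(\bigcup l,q)$ is in the relation). Let $V:u\to\mathbb{N}$, $v(n)=\{z\in u\mid V(z)=n\}$, $v'(n)=\{z\in u\mid V(z)<n\}$. If $a,b\subseteq u$ satisfy $\overline{b}\cap v(n)\subseteq S(v'(n))$ for all $n\in\mathbb{N}$ and $(a,b)\in\mathcal{L}_w$, then $(a,b)\in\mathcal{L}_m$.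
   Context: $\overline{p}=u\setminus p$. $\mathcal{L}_w$ and $\mathcal{L}_m$ are the leads-to relations of the event system under weak fairness and under minimal progress respectively. -}

module Defs where

open import Level using (0ℓ)
open import Data.Nat using (ℕ; _<_)
open import Data.Fin using (Fin)
open import Data.Product using (Σ; _×_)
open import Relation.Binary.PropositionalEquality using (_≡_)
open import Relation.Unary using (Pred; _⊆_; _≐_; _∩_; _∪_; ∁; ∅; ⋂; ⋃)

-- subsets of the universe u, modelled as predicates on a type A
Sub : Set → Set₁
Sub A = Pred A 0ℓ

Transformer : Set → Set₁
Transformer A = Sub A → Sub A

Univ : (A : Set) → Sub A
Univ A = λ _ → Data.Unit.⊤
  where import Data.Unit

-- well-definedness on sets: G maps equal sets to equal sets
RespectsEq : {A : Set} → Transformer A → Set₁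
RespectsEq {A} G = {p q : Sub A} → p ≐ q → G p ≐ G q

-- conjunctive: G distributes over every nonempty intersection
Conjunctive : {A : Set} → Transformer A → Set₁
Conjunctive {A} G =
  (I : Set) → I → (f : I → Sub A) → G (⋂ I f) ≐ ⋂ I (λ i → G (f i))

SS : {A : Set} {k : ℕ} → (Fin k → Transformer A) → Transformer A
SS {k = k} Gs r = ⋂ (Fin k) (λ i → Gs i r)

grd : {A : Set} → Transformer A → Sub A
grd T = ∁ (T ∅)

Em : {A : Set} {k : ℕ} → (Fin k → Transformer A) → Sub A → Sub A → Set
Em Gs a b = (a ∩ ∁ b) ⊆ (SS Gs b ∩ grd (SS Gs))

Ew : {A : Set} {k : ℕ} → (Fin k → Transformer A) → Sub A → Sub A → Set
Ew {k = k} Gs a b =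
  Σ (Fin k) (λ i → (a ∩ ∁ b) ⊆ (SS Gs (a ∪ b) ∩ (grd (Gs i) ∩ Gs i b)))

-- smallest transitive, disjunctive relation containing E (on extensional sets:
-- the disjunction rule concludes for any a equal, as a set, to ⋃ l)
data LeadsTo {A : Set} (E : Sub A → Sub A → Set) : Sub A → Sub A → Set₁ where
  base  : {a b : Sub A} → E a b → LeadsTo E a b
  trans : {a b c : Sub A} → LeadsTo E a b → LeadsTo E b c → LeadsTo E a c
  disj  : {a q : Sub A} (I : Set) (l : I → Sub A) →
          ((i : I) → LeadsTo E (l i) q) → a ≐ ⋃ I l → LeadsTo E a q

Lm : {A : Set} {k : ℕ} → (Fin k → Transformer A) → Sub A → Sub A → Set₁
Lm Gs = LeadsTo (Em Gs)

Lw : {A : Set} {k : ℕ} → (Fin k → Transformer A) → Sub A → Sub A → Set₁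
Lw Gs = LeadsTo (Ew Gs)

vEq : {A : Set} → (A → ℕ) → ℕ → Sub A
vEq V n = λ z → V z ≡ n

vLt : {A : Set} → (A → ℕ) → ℕ → Sub A
vLt V n = λ z → V z < n

module Submission where

-- A weakly fair step a ↦ c (by some G, with c ↦ b already known under minimal
-- progress) is split along the level sets of V: outside b, a point of a at level n satisfies
-- S(a ∪ c) and, by hypothesis, S(v'(n)); conjunctivity gives S((a ∪ c) ∩ v'(n)), and the guard of
-- G gives the guard of S. So each level is a minimal-progress step to the lower levels of a, c or b,
-- and induction on n yields a ↦ b. Induction on the derivation in 𝓛_w then finishes the proof.

open import Defs
open import Data.Nat using (ℕ; zero; suc; _<_)
open import Data.Nat.Properties using (m<1+n⇒m<n∨m≡n; n<1+n)
open import Data.Fin using (Fin)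
open import Data.Bool using (Bool; true; false; if_then_else_)
open import Data.Product using (_,_; proj₁; proj₂)
open import Data.Empty using (⊥-elim)
open import Data.Sum using (inj₁; inj₂; [_,_])
open import Function using (id; _∘_)
open import Relation.Unary using (_⊆_; _≐_; _∩_; _∪_; ∁; ⋂; ⋃)

module _ {A : Set} where

  ∩≐⋂ : (X Y : Sub A) → X ∩ Y ≐ ⋂ Bool (λ t → if t then X else Y)
  ∩≐⋂ X Y = (λ (x , y) → λ { true → x ; false → y }) , (λ h → h true , h false)

  ∪≐⋃ : (X Y : Sub A) → X ∪ Y ≐ ⋃ Bool (λ t → if t then X else Y)
  ∪≐⋃ X Y = [ (true ,_) , (false ,_) ]
          , (λ { (true , x) → inj₁ x ; (false , y) → inj₂ y })

  module _ {G : Transformer A} (resp : RespectsEq G) (conj : Conjunctive G) where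

    conjunctive-∩ : (X Y : Sub A) → G (X ∩ Y) ≐ G X ∩ G Y
    conjunctive-∩ X Y =
        (λ g → let h = proj₁ (conj Bool true _) (proj₁ (resp (∩≐⋂ X Y)) g) in h true , h false)
      , (λ (gx , gy) → proj₂ (resp (∩≐⋂ X Y))
                         (proj₂ (conj Bool true _) λ { true → gx ; false → gy }))

    conjunctive-mono : {X Y : Sub A} → X ⊆ Y → G X ⊆ G Y
    conjunctive-mono {X} {Y} X⊆Y =
      proj₂ ∘ proj₁ (conjunctive-∩ X Y) ∘ proj₁ (resp ((λ x → x , X⊆Y x) , proj₁))

    conjunctive-∩⊆ : {X Y W : Sub A} → X ∩ Y ⊆ W → G X ∩ G Y ⊆ G W
    conjunctive-∩⊆ {X} {Y} X∩Y⊆W = conjunctive-mono X∩Y⊆W ∘ proj₂ (conjunctive-∩ X Y)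

  module _ {E : Sub A → Sub A → Set} where

    LeadsTo-∪ : {X Y Z : Sub A} → LeadsTo E X Z → LeadsTo E Y Z → LeadsTo E (X ∪ Y) Z
    LeadsTo-∪ {X} {Y} X↦Z Y↦Z = disj Bool _ (λ { true → X↦Z ; false → Y↦Z }) (∪≐⋃ X Y)

    module _ (E-⊆ : {X Y : Sub A} → X ⊆ Y → E X Y) where

      ⊆⇒LeadsTo : {X Y : Sub A} → X ⊆ Y → LeadsTo E X Y
      ⊆⇒LeadsTo = base ∘ E-⊆

      LeadsTo-variant : (V : A → ℕ) {a b : Sub A} →
        ((n : ℕ) → LeadsTo E (a ∩ vEq V n) ((a ∩ vLt V n) ∪ b)) → LeadsTo E a b
      LeadsTo-variant V {a} {b} level↦ =
        disj ℕ (λ n → a ∩ vLt V n) below↦ ((λ {z} az → suc (V z) , az , n<1+n (V z)) , proj₁ ∘ proj₂)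
        where
        below↦ : (n : ℕ) → LeadsTo E (a ∩ vLt V n) b
        below↦ zero = ⊆⇒LeadsTo λ ()
        below↦ (suc n) = trans (⊆⇒LeadsTo split)
          (LeadsTo-∪ (below↦ n)
            (trans (level↦ n) (LeadsTo-∪ (below↦ n) (⊆⇒LeadsTo id))))
          where
          split : a ∩ vLt V (suc n) ⊆ (a ∩ vLt V n) ∪ (a ∩ vEq V n)
          split (az , lt) = [ (λ lt → inj₁ (az , lt)) , (λ eq → inj₂ (az , eq)) ]
                              (m<1+n⇒m<n∨m≡n lt)

  module _ {k : ℕ} (Gs : Fin k → Transformer A) where

    Em-⊆ : {X Y : Sub A} → X ⊆ Y → Em Gs X Y
    Em-⊆ X⊆Y (x , ¬y) = ⊥-elim (¬y (X⊆Y x))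

    module _ (resp : (i : Fin k) → RespectsEq (Gs i))
             (conj : (i : Fin k) → Conjunctive (Gs i))
             (V : A → ℕ) {b : Sub A}
             (variant : (n : ℕ) → (∁ b ∩ vEq V n) ⊆ SS Gs (vLt V n)) where

      Ew-level-Em : {a c : Sub A} → Ew Gs a c → (n : ℕ) →
        Em Gs (a ∩ vEq V n) ((a ∩ vLt V n) ∪ (c ∪ b))
      Ew-level-Em {a} {c} (i , step) n {z} ((az , Vz≡n) , ∉target) =
          (λ j → conjunctive-∩⊆ (resp j) (conj j) lower⊆target (S[a∪c] j , S[lower] j))
        , (λ S∅ → Gi-enabled (S∅ i))
        where
        S[a∪c] : SS Gs (a ∪ c) z
        S[a∪c] = proj₁ (step (az , ∉target ∘ inj₂ ∘ inj₁))
        Gi-enabled : grd (Gs i) z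
        Gi-enabled = proj₁ (proj₂ (step (az , ∉target ∘ inj₂ ∘ inj₁)))
        S[lower] : SS Gs (vLt V n) z
        S[lower] = variant n (∉target ∘ inj₂ ∘ inj₂ , Vz≡n)
        lower⊆target : (a ∪ c) ∩ vLt V n ⊆ (a ∩ vLt V n) ∪ (c ∪ b)
        lower⊆target (inj₁ az′ , lt) = inj₁ (az′ , lt)
        lower⊆target (inj₂ cz , _) = inj₂ (inj₁ cz)

      Ew-Lm-trans : {a c : Sub A} → Ew Gs a c → Lm Gs c b → Lm Gs a b
      Ew-Lm-trans {a} a↦c c↦b = LeadsTo-variant Em-⊆ V λ n →
        trans (base (Ew-level-Em a↦c n))
          (LeadsTo-∪ (⊆⇒LeadsTo Em-⊆ inj₁)
            (LeadsTo-∪ (trans c↦b (⊆⇒LeadsTo Em-⊆ inj₂)) (⊆⇒LeadsTo Em-⊆ inj₂)))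

      Lw-Lm-trans : {a c : Sub A} → Lw Gs a c → Lm Gs c b → Lm Gs a b
      Lw-Lm-trans (base a↦c) c↦b = Ew-Lm-trans a↦c c↦b
      Lw-Lm-trans (trans a↦d d↦c) c↦b = Lw-Lm-trans a↦d (Lw-Lm-trans d↦c c↦b)
      Lw-Lm-trans (disj I l l↦c a≐⋃l) c↦b = disj I l (λ i → Lw-Lm-trans (l↦c i) c↦b) a≐⋃l

mainTheorem7 : (A : Set) (k : ℕ) (Gs : Fin k → Transformer A) →
    ((i : Fin k) → RespectsEq (Gs i)) →
    ((i : Fin k) → Conjunctive (Gs i)) →
    ((i : Fin k) → Gs i (Univ A) ≐ Univ A) →
    (V : A → ℕ) (a b : Sub A) →
    ((n : ℕ) → (∁ b ∩ vEq V n) ⊆ SS Gs (vLt V n)) →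
    Lw Gs a b → Lm Gs a b
mainTheorem7 A k Gs resp conj _ V a b variant a↦b =
  Lw-Lm-trans Gs resp conj V variant a↦b (⊆⇒LeadsTo (Em-⊆ Gs) id)
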